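{- Let $G=(V,E)$ be an st-graph and let $S_c=\{C_1,C_2\}$ be a channel decomposition of $G$ of size $2$. Define $X(v)$ as the position in $C_1$ of $\mathrm{Proj}_{C_1}(v)$ and $Y(v)$ as the position in $C_2$ of $\mathrm{Proj}_{C_2}(v)$. Then any two distinct vertices $v,w\in V$ satisfy $(X(v),Y(v))\neq(X(w),Y(w))$.
   Context: An st-graph is a directed acyclic graph with exactly one source $s$ and one sink $t$. Vertex $v$ is reachable from $u$ if there is a directed path (possibly of length zero) from $u$ to $v$. A channel is a sequence of vertices such that for any two distinct vertices $v,w$ in it, $v$ precedes $w$ iff $w$ is reachable from $v$. A channel decomposition of size $k$ is a set of $k$ channels such that $s$ and $t$ belong to every channel (as first and last element) and every other vertex belongs to exactly one channel. Positions in a channel are numbered $0,1,\dots$ with $s$ at position $0$. The projection $\mathrm{Proj}_C(u)$ is the vertex of $C$ of lowest position among the vertices of $C$ reachable from $u$ (so $\mathrm{Proj}_C(u)=u$ if $u\in C$). -}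

module Defs where

open import Data.Nat using (ℕ; suc)
open import Data.Fin using (Fin; zero; fromℕ; _<_; _≤_)
open import Data.Product using (Σ; ∃; _×_; _,_)
open import Data.Sum using (_⊎_)
open import Relation.Nullary using (¬_)
open import Relation.Binary.PropositionalEquality using (_≡_; _≢_)
open import Relation.Binary.Construct.Closure.ReflexiveTransitive using (Star)
open import Function.Definitions using (Injective)

Graph : ℕ → Set₁
Graph n = Fin n → Fin n → Set

module _ {n : ℕ} (E : Graph n) where

  Reach : Fin n → Fin n → Set
  Reach = Star E

  Acyclic : Set
  Acyclic = ∀ u v → E u v → ¬ Reach v u

  IsSource : Fin n → Set
  IsSource v = ∀ u → ¬ E u v

  IsSink : Fin n → Set
  IsSink v = ∀ u → ¬ E v u

  IsSTGraph : Fin n → Fin n → Set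
  IsSTGraph s t =
    Acyclic × (IsSource s × (∀ v → IsSource v → v ≡ s))
            × (IsSink t × (∀ v → IsSink v → v ≡ t))

  record Channel : Set where
    field
      len  : ℕ
      at   : Fin (suc len) → Fin n
      distinct : Injective _≡_ _≡_ at
      order : ∀ i j → i ≢ j → ((i < j → Reach (at i) (at j)) × (Reach (at i) (at j) → i < j))
  open Channel public

  _∈C_ : Fin n → Channel → Set
  v ∈C C = ∃ λ i → at C i ≡ v

  IsDecomposition2 : Fin n → Fin n → Channel → Channel → Set
  IsDecomposition2 s t C₁ C₂ =
    (at C₁ zero ≡ s × at C₁ (fromℕ (len C₁)) ≡ t)
    × (at C₂ zero ≡ s × at C₂ (fromℕ (len C₂)) ≡ t)
    × (∀ v → v ≢ s → v ≢ t →
         ((v ∈C C₁) × ¬ (v ∈C C₂)) ⊎ (¬ (v ∈C C₁) × (v ∈C C₂)))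

  -- p is the position in C of Proj_C(u): the lowest position among the
  -- vertices of C reachable from u.
  IsProjPos : (C : Channel) → Fin n → Fin (suc (len C)) → Set
  IsProjPos C u p = Reach u (at C p) × (∀ q → Reach u (at C q) → p ≤ q)

-- The projection of a vertex onto the channel containing it is the vertex itself, and
-- every vertex reaches its projections. So if v and w have the same projections onto
-- both channels, w reaches v through the channel of v and v reaches w through the
-- channel of w, and acyclicity forces v = w.
module Submission where

open import Defs
open import Data.Nat using (ℕ; suc)
open import Data.Fin using (Fin; zero; fromℕ; _≟_)
open import Data.Fin.Properties using (≤∧≢⇒<; <-asym)
open import Data.Product using (_×_; _,_; proj₁; proj₂)
open import Data.Empty using (⊥-elim)
open import Data.Sum using (_⊎_; inj₁; inj₂)
open import Relation.Nullary using (¬_; yes; no)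
open import Relation.Binary.PropositionalEquality
  using (_≡_; _≢_; refl; sym; trans; subst; cong)
open import Relation.Binary.Construct.Closure.ReflexiveTransitive using (ε; _◅_; _◅◅_)

module _ {n : ℕ} (E : Graph n) where

  Reach-antisym : Acyclic E → ∀ {u v} → Reach E u v → Reach E v u → u ≡ v
  Reach-antisym acyclic ε           _   = refl
  Reach-antisym acyclic (e ◅ u⇝v) v⇝u = ⊥-elim (acyclic _ _ e (u⇝v ◅◅ v⇝u))

  projPos-of-member : (C : Channel E) {v : Fin n} {i p : Fin (suc (len C))} →
                      at C i ≡ v → IsProjPos E C v p → p ≡ i
  projPos-of-member C {i = i} {p} refl (v⇝p , minimal) with p ≟ i
  ... | yes p≡i = p≡i
  ... | no p≢i  = ⊥-elim (<-asym p<i i<p)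
    where
      p<i = ≤∧≢⇒< (minimal i ε) p≢i
      i<p = proj₂ (order C i p (λ i≡p → p≢i (sym i≡p))) v⇝p

  at-projPos-of-member : (C : Channel E) {v : Fin n} {p : Fin (suc (len C))} →
                         _∈C_ E v C → IsProjPos E C v p → at C p ≡ v
  at-projPos-of-member C (i , atᵢ≡v) proj =
    trans (cong (at C) (projPos-of-member C atᵢ≡v proj)) atᵢ≡v

  Reach-member-of-same-projPos : (C : Channel E) {v w : Fin n} {p : Fin (suc (len C))} →
                                 _∈C_ E v C → IsProjPos E C v p → IsProjPos E C w p → Reach E w v
  Reach-member-of-same-projPos C v∈C projᵥ (w⇝p , _) =
    subst (Reach E _) (at-projPos-of-member C v∈C projᵥ) w⇝p

  decomposition-covers : ∀ s t (C₁ C₂ : Channel E) → IsDecomposition2 E s t C₁ C₂ →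
                         ∀ v → _∈C_ E v C₁ ⊎ _∈C_ E v C₂
  decomposition-covers s t C₁ _ ((at₀≡s , atₗ≡t) , _ , partition) v with v ≟ s | v ≟ t
  ... | yes refl | _        = inj₁ (zero , at₀≡s)
  ... | no _     | yes refl = inj₁ (fromℕ (len C₁) , atₗ≡t)
  ... | no v≢s   | no v≢t   with partition v v≢s v≢t
  ...   | inj₁ (v∈C₁ , _) = inj₁ v∈C₁
  ...   | inj₂ (_ , v∈C₂) = inj₂ v∈C₂

  Reach-of-same-projPos₂ : (C₁ C₂ : Channel E) {v w : Fin n}
                           {x : Fin (suc (len C₁))} {y : Fin (suc (len C₂))} →
                           _∈C_ E v C₁ ⊎ _∈C_ E v C₂ →
                           IsProjPos E C₁ v x → IsProjPos E C₂ v y →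
                           IsProjPos E C₁ w x → IsProjPos E C₂ w y → Reach E w v
  Reach-of-same-projPos₂ C₁ _ (inj₁ v∈C₁) projᵥ _ projw _ =
    Reach-member-of-same-projPos C₁ v∈C₁ projᵥ projw
  Reach-of-same-projPos₂ _ C₂ (inj₂ v∈C₂) _ projᵥ _ projw =
    Reach-member-of-same-projPos C₂ v∈C₂ projᵥ projw

lemma5 : ∀ {n} (E : Graph n) (s t : Fin n) → IsSTGraph E s t →
    (C₁ C₂ : Channel E) → IsDecomposition2 E s t C₁ C₂ →
    ∀ v w → v ≢ w →
    ∀ (xv xw : Fin (suc (len C₁))) (yv yw : Fin (suc (len C₂))) →
    IsProjPos E C₁ v xv → IsProjPos E C₂ v yv →
    IsProjPos E C₁ w xw → IsProjPos E C₂ w yw →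
    ¬ (xv ≡ xw × yv ≡ yw)
lemma5 E s t st C₁ C₂ dec v w v≢w xv xw yv yw p₁v p₂v p₁w p₂w (refl , refl) =
  v≢w (Reach-antisym E (proj₁ st) v⇝w w⇝v)
  where
    covers : ∀ u → _∈C_ E u C₁ ⊎ _∈C_ E u C₂
    covers = decomposition-covers E s t C₁ C₂ dec
    w⇝v : Reach E w v
    w⇝v = Reach-of-same-projPos₂ E C₁ C₂ (covers v) p₁v p₂v p₁w p₂w
    v⇝w : Reach E v w
    v⇝w = Reach-of-same-projPos₂ E C₁ C₂ (covers w) p₁w p₂w p₁v p₂v
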